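{- Consider the execution of $\textsc{Move-Half}$ on a request sequence $\sigma$. Let $v$ be an item and let $t$ be either $0$ or a time at which $v$ was moved down in $\textsc{Move-Half}$'s tree, and let $t'>t$ be the first time after $t$ at which $v$ is requested. If the depth of $v$ in $\textsc{Move-Half}$'s tree at time $t'$ is $h$, then the depth of $v$ in an MRU tree at time $t'$ is at least $\lfloor h/2\rfloor$.
   Context: Self-adjusting complete tree model: a set $V$ of $n$ items is stored in a complete binary tree of $n$ servers, one item per server; the root has depth $0$ and an item's depth is that of its hosting server. The rank of item $v$ at time $t$ is the number of distinct items requested since the last request of $v$ before $t$, including $v$. In an MRU tree every item $v$ has depth $\lfloor\log_2 v.\mathrm{rank}\rfloor$. Algorithm $\textsc{Move-Half}$: it starts (at time $0$) from an MRU tree; upon a request to item $u$ at depth $d$ it accesses $u$, lets $v$ be the item of highest rank among the items at depth $\lfloor d/2\rfloor$, and interchanges the positions of $u$ and $v$ (all other items stay in place). -}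

module Defs where

open import Data.Nat using (ℕ; zero; suc; _∸_; _<_; _≤_; _<ᵇ_; ⌊_/2⌋)
open import Data.Nat.Logarithm using (⌊log₂_⌋)
open import Data.Fin using (Fin; toℕ; _≟_)
open import Data.List using (List; []; _∷_; _++_; map; reverse; upTo; length; deduplicate; foldr; allFin)
open import Data.Maybe using (Maybe; just; nothing)
open import Data.Bool using (Bool; true; false; if_then_else_)
open import Relation.Nullary using (yes; no)
open import Relation.Nullary.Decidable using (⌊_⌋)
open import Relation.Binary.PropositionalEquality using (_≡_)
open import Data.Nat.Properties using () renaming (_≟_ to _≟ℕ_)

-- Items and servers are both `Fin n`.  Server s (0-based) is heap node
-- (s+1) of the complete binary tree on n nodes, so its depth is ⌊log₂(s+1)⌋.
serverDepth : ∀ {n} → Fin n → ℕ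
serverDepth s = ⌊log₂ suc (toℕ s) ⌋

Placement : ℕ → Set
Placement n = Fin n → Fin n

depthOf : ∀ {n} → Placement n → Fin n → ℕ
depthOf pos v = serverDepth (pos v)

-- Request sequence σ : ℕ → Fin n ; σ i is the request at time (i+1),
-- i.e. requests occur at times 1, 2, 3, ...  (time 0 is the start).
-- `init` is a most-recent-first list of all items (the pre-history that
-- defines the ranks at time 0).
recency : ∀ {n} → List (Fin n) → (ℕ → Fin n) → ℕ → List (Fin n)
recency init σ t = reverse (map σ (upTo (t ∸ 1))) ++ init

upToFirst : ∀ {n} → Fin n → List (Fin n) → List (Fin n)
upToFirst v [] = []
upToFirst v (x ∷ xs) with v ≟ x
... | yes _ = x ∷ []
... | no  _ = x ∷ upToFirst v xs

rank : ∀ {n} → List (Fin n) → (ℕ → Fin n) → ℕ → Fin n → ℕ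
rank init σ t v = length (deduplicate _≟_ (upToFirst v (recency init σ t)))

IsMRU : ∀ {n} → (Fin n → ℕ) → Placement n → Set
IsMRU {n} rk pos = ∀ (v : Fin n) → depthOf pos v ≡ ⌊log₂ rk v ⌋

highestRankAt : ∀ {n} → (Fin n → ℕ) → Placement n → ℕ → Maybe (Fin n)
highestRankAt {n} rk pos δ = foldr step nothing (allFin n)
  where
  step : Fin n → Maybe (Fin n) → Maybe (Fin n)
  step w acc with depthOf pos w ≟ℕ δ | acc
  ... | no  _ | _       = acc
  ... | yes _ | nothing = just w
  ... | yes _ | just b  = if rk b <ᵇ rk w then just w else just b

swapItems : ∀ {n} → Placement n → Fin n → Fin n → Placement n
swapItems pos u v w with w ≟ u | w ≟ v
... | yes _ | _     = pos v
... | no  _ | yes _ = pos u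
... | no  _ | no  _ = pos w

moveHalfStep : ∀ {n} → (Fin n → ℕ) → Placement n → Fin n → Placement n
moveHalfStep rk pos u with highestRankAt rk pos ⌊ depthOf pos u /2⌋
... | nothing = pos
... | just v  = swapItems pos u v

-- Move-Half's tree at time k (after serving the requests at times 1..k);
-- the request at time k+1 (namely σ k) is served on `mhTree … k`
-- using the ranks at time k+1.
mhTree : ∀ {n} → List (Fin n) → Placement n → (ℕ → Fin n) → ℕ → Placement n
mhTree init pos0 σ zero    = pos0
mhTree init pos0 σ (suc k) =
  moveHalfStep (rank init σ (suc k)) (mhTree init pos0 σ k) (σ k)

requestAt : ∀ {n} → (ℕ → Fin n) → ℕ → Fin n
requestAt σ t = σ (t ∸ 1)

-- depth of v in Move-Half's tree at time t ≥ 1, i.e. when the request at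
-- time t is issued (before it is served)
depthAt : ∀ {n} → List (Fin n) → Placement n → (ℕ → Fin n) → ℕ → Fin n → ℕ
depthAt init pos0 σ t v = depthOf (mhTree init pos0 σ (t ∸ 1)) v

MovedDownAt : ∀ {n} → List (Fin n) → Placement n → (ℕ → Fin n) → ℕ → Fin n → Set
MovedDownAt init pos0 σ t v =
  depthOf (mhTree init pos0 σ (t ∸ 1)) v < depthOf (mhTree init pos0 σ t) v

-- While v is not requested its rank never decreases, and Move-Half moves v
-- down only when v has the highest rank among the items at depth ⌊d/2⌋ and
-- lands at depth d.  Level ⌊d/2⌋ < d is then full, so its 2^⌊d/2⌋ items all
-- have rank at most rank v; an item of rank at most rank v was requested no
-- earlier than the last request of v, so it is among the rank v distinct
-- items requested since then.  Hence 2^⌊depth v / 2⌋ ≤ rank v holds right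
-- after time t (for t = 0 because the tree is MRU) and survives every step up
-- to t', where it yields ⌊h/2⌋ ≤ ⌊log₂ rank v⌋.

module Submission where

open import Defs
open import Data.Bool using (true; false)
open import Data.Fin using (Fin; zero; suc; toℕ; _≟_; _↑ʳ_; inject≤; punchOut)
open import Data.Fin.Properties
  using (injective⇒≤; punchOut-injective; any?; toℕ-↑ʳ; toℕ-inject≤; ↑ʳ-injective; inject≤-injective; toℕ<n)
open import Data.List using (List; []; _∷_; _++_; [_]; length; lookup; deduplicate; map; upTo; reverse; foldr; allFin)
open import Data.List.Properties using (upTo-∷ʳ; map-++; reverse-++)
open import Data.List.Membership.Propositional using (_∈_; _∉_)
open import Data.List.Membership.Propositional.Properties
  using (∈-lookup; ∈-deduplicate⁺; ∈-deduplicate⁻; ∈-++⁺ʳ; ∈-allFin)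
import Data.List.Membership.Setoid.Properties as SetoidMembership
open import Data.List.Relation.Binary.Subset.Propositional using (_⊆_)
open import Data.List.Relation.Binary.Subset.Propositional.Properties using (∷⁺ʳ)
open import Data.List.Relation.Unary.All as All using (All; []; _∷_)
open import Data.List.Relation.Unary.Any as Any using (here; there)
open import Data.List.Relation.Unary.AllPairs using ([]; _∷_)
open import Data.List.Relation.Unary.Unique.Propositional using (Unique)
open import Data.List.Relation.Unary.Unique.DecPropositional.Properties using (deduplicate-!)
open import Data.Maybe using (Maybe; just; nothing)
open import Data.Nat using (ℕ; zero; suc; _+_; _∸_; _^_; _<_; _≤_; _<ᵇ_; z≤n; s≤s; s≤s⁻¹; z<s; pred; ⌊_/2⌋)
open import Data.Nat.Properties hiding (_≟_)
open import Data.Nat.Properties using () renaming (_≟_ to _≟ℕ_)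
open import Data.Nat.Logarithm using (⌊log₂_⌋; ⌊log₂⌋-mono-≤; ⌊log₂⌊n/2⌋⌋≡⌊log₂n⌋∸1; ⌊log₂[2^n]⌋≡n)
open import Data.Product using (Σ; _×_; _,_; proj₁; proj₂)
open import Data.Sum using (_⊎_; inj₁; inj₂)
open import Function.Definitions using (Injective; StrictlySurjective)
open import Relation.Nullary using (yes; no; contradiction)
open import Relation.Nullary.Reflects using (ofʸ; ofⁿ)
open import Relation.Binary.PropositionalEquality hiding ([_])
open import Function using (_∘_)

lookup-injective : ∀ {A : Set} {xs : List A} → Unique xs → Injective _≡_ _≡_ (lookup xs)
lookup-injective (_ ∷ _)  {zero}  {zero}  _ = refl
lookup-injective (x∉ ∷ _) {zero}  {suc j} e = contradiction e (All.lookup x∉ (∈-lookup j))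
lookup-injective (x∉ ∷ _) {suc i} {zero}  e = contradiction (sym e) (All.lookup x∉ (∈-lookup i))
lookup-injective (_ ∷ u)  {suc i} {suc j} e = cong suc (lookup-injective u e)

Unique-⊆⇒length≤ : ∀ {A : Set} {xs ys : List A} → Unique xs → xs ⊆ ys → length xs ≤ length ys
Unique-⊆⇒length≤ {A} xs! xs⊆ys = injective⇒≤ λ {i} {j} eq →
  lookup-injective xs!
    (SetoidMembership.index-injective (setoid A) (xs⊆ys (∈-lookup i)) (xs⊆ys (∈-lookup j)) eq)

rankIn : ∀ {n} → List (Fin n) → Fin n → ℕ
rankIn L v = length (deduplicate _≟_ (upToFirst v L))

module _ {n : ℕ} where

  ∈-upToFirst : ∀ {v : Fin n} {L} → v ∈ L → v ∈ upToFirst v L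
  ∈-upToFirst {v} {x ∷ L} v∈ with v ≟ x | v∈
  ... | yes v≡x | _         = here v≡x
  ... | no  v≢x | here v≡x  = contradiction v≡x v≢x
  ... | no  _   | there v∈L = there (∈-upToFirst v∈L)

  upToFirst-⊆ : ∀ {w b : Fin n} {L} → w ∈ L → w ∉ upToFirst b L → upToFirst b L ⊆ upToFirst w L
  upToFirst-⊆ {w} {b} {x ∷ L} w∈ w∉ with b ≟ x | w ≟ x
  ... | yes _ | yes w≡x = contradiction (here w≡x) w∉
  ... | no _  | yes w≡x = contradiction (here w≡x) w∉
  ... | yes _ | no _    = λ { (here refl) → here refl }
  ... | no _  | no w≢x  with w∈
  ...   | here w≡x  = contradiction w≡x w≢x
  ...   | there w∈L = ∷⁺ʳ x (upToFirst-⊆ w∈L (λ w∈P → w∉ (there w∈P)))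

  rankIn-pos : ∀ {v : Fin n} {L} → v ∈ L → 1 ≤ rankIn L v
  rankIn-pos v∈L = Unique-⊆⇒length≤ ([] ∷ []) λ { (here refl) → ∈-deduplicate⁺ _≟_ (∈-upToFirst v∈L) }

  rankIn-∷ : ∀ {x v : Fin n} L → x ≢ v → rankIn L v ≤ rankIn (x ∷ L) v
  rankIn-∷ {x} {v} L x≢v with v ≟ x
  ... | yes v≡x = contradiction (sym v≡x) x≢v
  ... | no _    = Unique-⊆⇒length≤ (deduplicate-! _≟_ (upToFirst v L))
                    (λ y∈ → ∈-deduplicate⁺ _≟_ (there (∈-deduplicate⁻ _≟_ (upToFirst v L) y∈)))

  rankIn-< : ∀ {w b : Fin n} {L} → w ∈ L → w ∉ upToFirst b L → rankIn L b < rankIn L w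
  rankIn-< {w} {b} {L} w∈L w∉ = Unique-⊆⇒length≤ (w∉D ∷ deduplicate-! _≟_ (upToFirst b L)) sub
    where
    w∉D : All (w ≢_) (deduplicate _≟_ (upToFirst b L))
    w∉D = All.tabulate λ y∈ w≡y → w∉ (subst (_∈ upToFirst b L) (sym w≡y) (∈-deduplicate⁻ _≟_ (upToFirst b L) y∈))
    sub : w ∷ deduplicate _≟_ (upToFirst b L) ⊆ deduplicate _≟_ (upToFirst w L)
    sub (here refl) = ∈-deduplicate⁺ _≟_ (∈-upToFirst w∈L)
    sub (there y∈)  = ∈-deduplicate⁺ _≟_ (upToFirst-⊆ w∈L w∉ (∈-deduplicate⁻ _≟_ (upToFirst b L) y∈))

  rankIn-≤⇒∈-upToFirst : ∀ {w b : Fin n} {L} → w ∈ L → rankIn L w ≤ rankIn L b → w ∈ upToFirst b L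
  rankIn-≤⇒∈-upToFirst {w} {b} {L} w∈L w≤b with Any.any? (w ≟_) (upToFirst b L)
  ... | yes w∈ = w∈
  ... | no  w∉ = contradiction w≤b (<⇒≱ (rankIn-< w∈L w∉))

m<n+n⇒⌊m/2⌋<n : ∀ m n → m < n + n → ⌊ m /2⌋ < n
m<n+n⇒⌊m/2⌋<n zero          (suc n) _ = z<s
m<n+n⇒⌊m/2⌋<n (suc zero)    (suc n) _ = z<s
m<n+n⇒⌊m/2⌋<n (suc (suc m)) (suc n) m<n+n rewrite +-suc n n =
  s≤s (m<n+n⇒⌊m/2⌋<n m n (s≤s⁻¹ (s≤s⁻¹ m<n+n)))

2^[1+j]≡2^j+2^j : ∀ j → 2 ^ suc j ≡ 2 ^ j + 2 ^ j
2^[1+j]≡2^j+2^j j = cong (2 ^ j +_) (+-identityʳ (2 ^ j))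

m<2^[1+j]⇒⌊log₂m⌋≤j : ∀ j m → m < 2 ^ suc j → ⌊log₂ m ⌋ ≤ j
m<2^[1+j]⇒⌊log₂m⌋≤j zero    m m<2 = ⌊log₂⌋-mono-≤ (s≤s⁻¹ m<2)
m<2^[1+j]⇒⌊log₂m⌋≤j (suc j) m m<2^[2+j] = ≤-trans (m≤n+m∸n ⌊log₂ m ⌋ 1) (s≤s log-half≤j)
  where
  log-half≤j : ⌊log₂ m ⌋ ∸ 1 ≤ j
  log-half≤j = subst (_≤ j) (⌊log₂⌊n/2⌋⌋≡⌊log₂n⌋∸1 m)
    (m<2^[1+j]⇒⌊log₂m⌋≤j j ⌊ m /2⌋
      (m<n+n⇒⌊m/2⌋<n m (2 ^ suc j) (subst (m <_) (2^[1+j]≡2^j+2^j (suc j)) m<2^[2+j])))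

2^⌊log₂m⌋≤m : ∀ m → 1 ≤ m → 2 ^ ⌊log₂ m ⌋ ≤ m
2^⌊log₂m⌋≤m m 1≤m with ⌊log₂ m ⌋ in log≡
... | zero  = 1≤m
... | suc j = ≮⇒≥ λ m<2^[1+j] → 1+n≰n (subst (_≤ j) log≡ (m<2^[1+j]⇒⌊log₂m⌋≤j j m m<2^[1+j]))

2^j≤m⇒j≤⌊log₂m⌋ : ∀ j m → 2 ^ j ≤ m → j ≤ ⌊log₂ m ⌋
2^j≤m⇒j≤⌊log₂m⌋ j m 2^j≤m = subst (_≤ ⌊log₂ m ⌋) (⌊log₂[2^n]⌋≡n j) (⌊log₂⌋-mono-≤ 2^j≤m)

2^j≤m<2^[1+j]⇒⌊log₂m⌋≡j : ∀ j {m} → 2 ^ j ≤ m → m < 2 ^ suc j → ⌊log₂ m ⌋ ≡ j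
2^j≤m<2^[1+j]⇒⌊log₂m⌋≡j j {m} 2^j≤m m<2^[1+j] =
  ≤-antisym (m<2^[1+j]⇒⌊log₂m⌋≤j j m m<2^[1+j]) (2^j≤m⇒j≤⌊log₂m⌋ j m 2^j≤m)

2^serverDepth≤n : ∀ {n} (s : Fin n) → 2 ^ serverDepth s ≤ n
2^serverDepth≤n s = ≤-trans (2^⌊log₂m⌋≤m (suc (toℕ s)) (s≤s z≤n)) (toℕ<n s)

module _ (j : ℕ) {n : ℕ} (2^[1+j]≤n : 2 ^ suc j ≤ n) where

  private
    level-start+level-size≤n : pred (2 ^ j) + 2 ^ j ≤ n
    level-start+level-size≤n = ≤-trans (+-monoˡ-≤ (2 ^ j) pred[n]≤n)
                                 (subst (_≤ n) (2^[1+j]≡2^j+2^j j) 2^[1+j]≤n)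

  -- Level j consists of the heap nodes 2^j, …, 2^(j+1) − 1, i.e. the servers 2^j − 1 + i.
  levelServer : Fin (2 ^ j) → Fin n
  levelServer i = inject≤ (pred (2 ^ j) ↑ʳ i) level-start+level-size≤n

  levelServer-injective : Injective _≡_ _≡_ levelServer
  levelServer-injective {i} {k} eq =
    ↑ʳ-injective (pred (2 ^ j)) i k (inject≤-injective _ _ _ _ eq)

  suc-toℕ-levelServer : ∀ i → suc (toℕ (levelServer i)) ≡ 2 ^ j + toℕ i
  suc-toℕ-levelServer i = begin
    suc (toℕ (levelServer i))        ≡⟨ cong suc (toℕ-inject≤ (pred (2 ^ j) ↑ʳ i) _) ⟩
    suc (toℕ (pred (2 ^ j) ↑ʳ i))    ≡⟨ cong suc (toℕ-↑ʳ (pred (2 ^ j)) i) ⟩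
    suc (pred (2 ^ j)) + toℕ i       ≡⟨ cong (_+ toℕ i) (suc-pred (2 ^ j)) ⟩
    2 ^ j + toℕ i                    ∎
    where
    open ≡-Reasoning
    instance _ = m^n≢0 2 j

  serverDepth-levelServer : ∀ i → serverDepth (levelServer i) ≡ j
  serverDepth-levelServer i = subst (λ m → ⌊log₂ m ⌋ ≡ j) (sym (suc-toℕ-levelServer i))
    (2^j≤m<2^[1+j]⇒⌊log₂m⌋≡j j (m≤m+n (2 ^ j) (toℕ i))
      (subst (2 ^ j + toℕ i <_) (sym (2^[1+j]≡2^j+2^j j)) (+-monoʳ-< (2 ^ j) (toℕ<n i))))

injective⇒strictlySurjective : ∀ {n} {f : Fin n → Fin n} → Injective _≡_ _≡_ f → StrictlySurjective _≡_ f
injective⇒strictlySurjective {suc n} {f} f-inj s with any? (λ w → f w ≟ s)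
... | yes hit = hit
... | no miss = contradiction (injective⇒≤ punchOut∘f-injective) 1+n≰n
  where
  s≢f : ∀ w → s ≢ f w
  s≢f w s≡fw = miss (w , sym s≡fw)
  punchOut∘f-injective : Injective _≡_ _≡_ (λ w → punchOut (s≢f w))
  punchOut∘f-injective {w} {w′} eq = f-inj (punchOut-injective (s≢f w) (s≢f w′) eq)

module _ {n} {pos : Placement n} (pos-surj : StrictlySurjective _≡_ pos) where

  covers-level⇒2^≤length : ∀ j {D : List (Fin n)} → 2 ^ suc j ≤ n →
                           (∀ w → depthOf pos w ≡ j → w ∈ D) → 2 ^ j ≤ length D
  covers-level⇒2^≤length j {D} 2^[1+j]≤n covers = injective⇒≤ index-injective
    where
    host : Fin (2 ^ j) → Fin n
    host i = proj₁ (pos-surj (levelServer j 2^[1+j]≤n i))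
    pos-host : ∀ i → pos (host i) ≡ levelServer j 2^[1+j]≤n i
    pos-host i = proj₂ (pos-surj (levelServer j 2^[1+j]≤n i))
    host∈D : ∀ i → host i ∈ D
    host∈D i = covers (host i) (trans (cong serverDepth (pos-host i)) (serverDepth-levelServer j 2^[1+j]≤n i))
    index-injective : Injective _≡_ _≡_ (λ i → Any.index (host∈D i))
    index-injective {i} {k} eq = levelServer-injective j 2^[1+j]≤n
      (trans (sym (pos-host i)) (trans (cong pos same-host) (pos-host k)))
      where
      same-host : host i ≡ host k
      same-host = SetoidMembership.index-injective (setoid (Fin n)) (host∈D i) (host∈D k) eq

OutranksLevel : ∀ {n} → (Fin n → ℕ) → Placement n → ℕ → Fin n → Set
OutranksLevel rk pos δ v = ∀ w → depthOf pos w ≡ δ → rk w ≤ rk v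

module _ {n} {pos : Placement n} (pos-surj : StrictlySurjective _≡_ pos) {L : List (Fin n)} (L-complete : ∀ w → w ∈ L) where

  outranksLevel⇒2^≤rankIn : ∀ j {v} → 2 ^ suc j ≤ n → OutranksLevel (rankIn L) pos j v → 2 ^ j ≤ rankIn L v
  outranksLevel⇒2^≤rankIn j 2^[1+j]≤n outranks = covers-level⇒2^≤length pos-surj j 2^[1+j]≤n
    λ w w-at-j → ∈-deduplicate⁺ _≟_ (rankIn-≤⇒∈-upToFirst (L-complete w) (outranks w w-at-j))

  outranksHalfLevel⇒2^≤rankIn : ∀ d {v} → 2 ^ d ≤ n → OutranksLevel (rankIn L) pos ⌊ d /2⌋ v → 2 ^ ⌊ d /2⌋ ≤ rankIn L v
  outranksHalfLevel⇒2^≤rankIn zero    {v} _     _        = rankIn-pos (L-complete v)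
  outranksHalfLevel⇒2^≤rankIn (suc d) 2^d≤n outranks =
    outranksLevel⇒2^≤rankIn ⌊ suc d /2⌋ (≤-trans (^-monoʳ-≤ 2 (⌊n/2⌋<n d)) 2^d≤n) outranks

module _ {n} (rk : Fin n → ℕ) (pos : Placement n) (δ : ℕ) where

  private
    -- `highestRankAt` folds a step function local to its `where` block; unification recovers it.
    step-fold : Σ (Fin n → Maybe (Fin n) → Maybe (Fin n)) λ step →
                  highestRankAt rk pos δ ≡ foldr step nothing (allFin n)
    step-fold = _ , refl

    step : Fin n → Maybe (Fin n) → Maybe (Fin n)
    step = proj₁ step-fold

    MaximumAtδ : List (Fin n) → Maybe (Fin n) → Set
    MaximumAtδ xs nothing  = All (λ w → depthOf pos w ≢ δ) xs
    MaximumAtδ xs (just b) = depthOf pos b ≡ δ × All (λ w → depthOf pos w ≡ δ → rk w ≤ rk b) xs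

    step-maximum : ∀ x {xs} acc → MaximumAtδ xs acc → MaximumAtδ (x ∷ xs) (step x acc)
    step-maximum x nothing  none with depthOf pos x ≟ℕ δ
    ... | no  x∉δ = x∉δ ∷ none
    ... | yes x∈δ = x∈δ , (λ _ → ≤-refl) ∷ All.map (λ w∉δ w∈δ → contradiction w∈δ w∉δ) none
    step-maximum x (just b) (b∈δ , b-max) with depthOf pos x ≟ℕ δ
    ... | no  x∉δ = b∈δ , (λ x∈δ → contradiction x∈δ x∉δ) ∷ b-max
    ... | yes x∈δ with rk b <ᵇ rk x | <ᵇ-reflects-< (rk b) (rk x)
    ...   | true  | ofʸ b<x = x∈δ , (λ _ → ≤-refl) ∷ All.map (λ w≤b w∈δ → ≤-trans (w≤b w∈δ) (<⇒≤ b<x)) b-max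
    ...   | false | ofⁿ b≮x = b∈δ , (λ _ → ≮⇒≥ b≮x) ∷ b-max

    fold-maximum : ∀ xs → MaximumAtδ xs (foldr step nothing xs)
    fold-maximum []       = []
    fold-maximum (x ∷ xs) = step-maximum x (foldr step nothing xs) (fold-maximum xs)

  highestRankAt-spec : ∀ {b} → highestRankAt rk pos δ ≡ just b → depthOf pos b ≡ δ × OutranksLevel rk pos δ b
  highestRankAt-spec eq =
    let b∈δ , b-max = subst (MaximumAtδ (allFin n)) eq (fold-maximum (allFin n))
    in  b∈δ , λ w w∈δ → All.lookup b-max (∈-allFin w) w∈δ

module _ {n} (pos : Placement n) (u b : Fin n) where

  swapItems-u : swapItems pos u b u ≡ pos b
  swapItems-u with u ≟ u
  ... | yes _   = refl
  ... | no  u≢u = contradiction refl u≢u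

  swapItems-b : swapItems pos u b b ≡ pos u
  swapItems-b with b ≟ u | b ≟ b
  ... | yes b≡u | _       = cong pos b≡u
  ... | no  _   | yes _   = refl
  ... | no  _   | no  b≢b = contradiction refl b≢b

  swapItems-other : ∀ {w} → w ≢ u → w ≢ b → swapItems pos u b w ≡ pos w
  swapItems-other {w} w≢u w≢b with w ≟ u | w ≟ b
  ... | yes w≡u | _       = contradiction w≡u w≢u
  ... | no  _   | yes w≡b = contradiction w≡b w≢b
  ... | no  _   | no  _   = refl

  swapItems-surjective : StrictlySurjective _≡_ pos → StrictlySurjective _≡_ (swapItems pos u b)
  swapItems-surjective pos-surj s with pos-surj s
  ... | w , pos-w≡s with w ≟ u | w ≟ b
  ...   | yes refl | _        = b , trans swapItems-b pos-w≡s
  ...   | no  _    | yes refl = u , trans swapItems-u pos-w≡s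
  ...   | no  w≢u  | no  w≢b  = w , trans (swapItems-other w≢u w≢b) pos-w≡s

moveHalfStep-surjective : ∀ {n} (rk : Fin n → ℕ) {pos : Placement n} u →
                          StrictlySurjective _≡_ pos → StrictlySurjective _≡_ (moveHalfStep rk pos u)
moveHalfStep-surjective rk {pos} u pos-surj with highestRankAt rk pos ⌊ depthOf pos u /2⌋
... | nothing = pos-surj
... | just b  = swapItems-surjective pos u b pos-surj

moveHalfStep-depth-≤⊎outranks : ∀ {n} (rk : Fin n → ℕ) pos (u v : Fin n) →
  depthOf (moveHalfStep rk pos u) v ≤ depthOf pos v ⊎
  (u ≢ v × OutranksLevel rk pos ⌊ depthOf (moveHalfStep rk pos u) v /2⌋ v)
moveHalfStep-depth-≤⊎outranks rk pos u v with highestRankAt rk pos ⌊ depthOf pos u /2⌋ in highest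
... | nothing = inj₁ ≤-refl
... | just b with v ≟ u
...   | yes refl = inj₁ (subst (_≤ depthOf pos v) (sym (proj₁ (highestRankAt-spec rk pos _ highest))) (⌊n/2⌋≤n _))
...   | no  v≢u with v ≟ b
...     | yes refl = inj₂ ((λ u≡v → v≢u (sym u≡v)) , proj₂ (highestRankAt-spec rk pos _ highest))
...     | no  _    = inj₁ ≤-refl

module _ {n} (init : List (Fin n)) (σ : ℕ → Fin n) where

  recency-suc : ∀ k → recency init σ (suc (suc k)) ≡ σ k ∷ recency init σ (suc k)
  recency-suc k = cong (_++ init) (begin
    reverse (map σ (upTo (suc k)))        ≡⟨ cong (reverse ∘ map σ) (sym (upTo-∷ʳ k)) ⟩
    reverse (map σ (upTo k ++ [ k ]))     ≡⟨ cong reverse (map-++ σ (upTo k) [ k ]) ⟩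
    reverse (map σ (upTo k) ++ [ σ k ])   ≡⟨ reverse-++ (map σ (upTo k)) [ σ k ] ⟩
    σ k ∷ reverse (map σ (upTo k))        ∎)
    where open ≡-Reasoning

  rank-suc-mono : ∀ k {v} → σ k ≢ v → rank init σ (suc k) v ≤ rank init σ (suc (suc k)) v
  rank-suc-mono k σk≢v rewrite recency-suc k = rankIn-∷ (recency init σ (suc k)) σk≢v

module MoveHalfRun {n} (init : List (Fin n)) (init-complete : ∀ w → w ∈ init)
                   (pos0 : Placement n) (pos0-injective : Injective _≡_ _≡_ pos0)
                   (σ : ℕ → Fin n) (v : Fin n) where

  tree : ℕ → Placement n
  tree = mhTree init pos0 σ

  tree-surjective : ∀ k → StrictlySurjective _≡_ (tree k)
  tree-surjective zero    = injective⇒strictlySurjective pos0-injective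
  tree-surjective (suc k) = moveHalfStep-surjective _ (σ k) (tree-surjective k)

  recency-complete : ∀ t w → w ∈ recency init σ t
  recency-complete t w = ∈-++⁺ʳ (reverse (map σ (upTo (t ∸ 1)))) (init-complete w)

  -- tree k serves the request at time k + 1, with the ranks at that time.
  RankBoundsDepth : ℕ → Set
  RankBoundsDepth k = 2 ^ ⌊ depthOf (tree k) v /2⌋ ≤ rank init σ (suc k) v

  swapped-down-bounds : ∀ k → σ k ≢ v →
    OutranksLevel (rank init σ (suc k)) (tree k) ⌊ depthOf (tree (suc k)) v /2⌋ v → RankBoundsDepth (suc k)
  swapped-down-bounds k σk≢v outranks = ≤-trans
    (outranksHalfLevel⇒2^≤rankIn (tree-surjective k) (recency-complete (suc k))
       (depthOf (tree (suc k)) v) (2^serverDepth≤n (tree (suc k) v)) outranks)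
    (rank-suc-mono init σ k σk≢v)

  bounds-step : ∀ k → σ k ≢ v → RankBoundsDepth k → RankBoundsDepth (suc k)
  bounds-step k σk≢v bound with moveHalfStep-depth-≤⊎outranks (rank init σ (suc k)) (tree k) (σ k) v
  ... | inj₁ not-down       = ≤-trans (^-monoʳ-≤ 2 (⌊n/2⌋-mono not-down)) (≤-trans bound (rank-suc-mono init σ k σk≢v))
  ... | inj₂ (_ , outranks) = swapped-down-bounds k σk≢v outranks

  bounds-movedDown : ∀ k → MovedDownAt init pos0 σ (suc k) v → RankBoundsDepth (suc k)
  bounds-movedDown k down with moveHalfStep-depth-≤⊎outranks (rank init σ (suc k)) (tree k) (σ k) v
  ... | inj₁ not-down             = contradiction not-down (<⇒≱ down)
  ... | inj₂ (σk≢v , outranks)    = swapped-down-bounds k σk≢v outranks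

  bounds-initially : IsMRU (rank init σ 0) pos0 → RankBoundsDepth 0
  bounds-initially mru = ≤-trans (^-monoʳ-≤ 2 (≤-trans (⌊n/2⌋≤n _) (≤-reflexive (mru v))))
                           (2^⌊log₂m⌋≤m r (rankIn-pos (recency-complete 0 v)))
    where
    r : ℕ
    r = rank init σ 0 v

  bounds-while-unrequested : ∀ {t} m → RankBoundsDepth t → (∀ k → t ≤ k → k < m → σ k ≢ v) → t ≤ m →
                             RankBoundsDepth m
  bounds-while-unrequested zero    bound _           t≤0   = subst RankBoundsDepth (n≤0⇒n≡0 t≤0) bound
  bounds-while-unrequested (suc m) bound unrequested t≤1+m with m≤n⇒m<n∨m≡n t≤1+m
  ... | inj₂ t≡1+m = subst RankBoundsDepth t≡1+m bound
  ... | inj₁ t≤m   = bounds-step m (unrequested m (s≤s⁻¹ t≤m) ≤-refl)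
    (bounds-while-unrequested m bound (λ k t≤k k<m → unrequested k t≤k (m<n⇒m<1+n k<m)) (s≤s⁻¹ t≤m))

claim1 : (n : ℕ) (init : List (Fin n)) → Unique init → (∀ v → v ∈ init) →
         (pos0 : Placement n) → Injective _≡_ _≡_ pos0 →
         (σ : ℕ → Fin n) → IsMRU (rank init σ 0) pos0 →
         (v : Fin n) (t t' : ℕ) →
         (t ≡ 0 ⊎ (1 ≤ t × MovedDownAt init pos0 σ t v)) →
         t < t' → requestAt σ t' ≡ v →
         (∀ s → t < s → s < t' → requestAt σ s ≢ v) →
         (h : ℕ) → depthAt init pos0 σ t' v ≡ h →
         ⌊ h /2⌋ ≤ ⌊log₂ rank init σ t' v ⌋
claim1 n init _ init-complete pos0 pos0-injective σ mru v t (suc m) start t<t' _ unrequested _ refl =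
  2^j≤m⇒j≤⌊log₂m⌋ _ _ (bounds-while-unrequested m (bounds-at t start)
    (λ k t≤k k<m → unrequested (suc k) (s≤s t≤k) (s≤s k<m)) (s≤s⁻¹ t<t'))
  where
  open MoveHalfRun init init-complete pos0 pos0-injective σ v
  bounds-at : ∀ t → (t ≡ 0 ⊎ (1 ≤ t × MovedDownAt init pos0 σ t v)) → RankBoundsDepth t
  bounds-at _       (inj₁ refl)        = bounds-initially mru
  bounds-at (suc k) (inj₂ (_ , down))  = bounds-movedDown k down
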